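{- Let $n\geq 3$ be odd and let $(P,\mathcal{L})$ be an $r$-uniform linear system with $r\geq n$ such that $(P,\mathcal{L})\simeq\mathcal{C}_{n,n+1}$. Then $$\tau(P,\mathcal{L})\leq \frac{|P|+|\mathcal{L}|}{n+1}.$$ Moreover, equality holds if and only if $(P,\mathcal{L})=\mathcal{C}_{n,n+1}$.
   Context: A linear system is a pair $(P,\mathcal{L})$ where $P$ is a finite set (points) and $\mathcal{L}$ is a family of subsets of $P$ (lines) such that $|l\cap l'|\leq 1$ for all distinct $l,l'\in\mathcal{L}$; it is $r$-uniform if every line has exactly $r$ points. The degree of a point is the number of lines containing it. A transversal is a set $T\subseteq P$ meeting every line; $\tau(P,\mathcal{L})$ is the minimum size of a transversal. Two linear systems are called isomorphic, written $\simeq$, if after deleting all points of degree $0$ or $1$ from both, they are isomorphic as hypergraphs. The system $\mathcal{C}_{n,n+1}=(P_n,\mathcal{L}_n)$: let $(\Gamma,+)$ be an additive abelian group of order $n$ with neutral element $e$ such that $\sum_{g\in\Gamma}g=e$ and $2g\neq e$ for all $g\neq e$ (e.g. $\mathbb{Z}_n$). Put $P_n=(\Gamma\times(\Gamma\setminus\{e\}))\cup\{p,q\}$ with $p,q$ two new points. The lines are: $L_g=\{(h,g):h\in\Gamma\}$ for $g\in\Gamma\setminus\{e\}$; $l_{p_g}=\{(g,h):h\in\Gamma\setminus\{e\}\}\cup\{p\}$ for $g\in\Gamma$; and $l_{q_g}=\{(h,h+g):h\in\Gamma,\ h+g\neq e\}\cup\{q\}$ for $g\in\Gamma$. This is an $n$-uniform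 linear system with $n(n-1)+2$ points and $3n-1$ lines. -}

module Defs where

open import Level using (0ℓ)
open import Data.Nat using (ℕ; suc; _*_; _≤_)
open import Data.Fin using (Fin)
open import Data.Fin.Subset using (Subset; _∈_; _∩_; ∣_∣)
open import Data.Vec using (tabulate; lookup)
open import Data.List using (foldr; allFin)
open import Data.Product using (Σ; ∃; _×_; proj₁)
open import Data.Sum using (_⊎_; inj₁; inj₂)
open import Data.Unit using (⊤)
open import Data.Empty using (⊥)
open import Relation.Binary.PropositionalEquality using (_≡_; _≢_)
open import Relation.Nullary.Decidable using (False)
open import Function.Bundles using (_↔_; _⇔_; Inverse)
import Algebra.Structures as AS
open import Data.Fin using (_≟_)

Odd : ℕ → Set
Odd n = ∃ λ j → n ≡ suc (2 * j)

-- An abelian group Γ of order n, presented on the carrier Fin n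
-- (every finite abelian group of order n is isomorphic to one of these),
-- satisfying the standing assumptions of the construction of C_{n,n+1}:
-- the sum of all elements is e, and 2g ≠ e for all g ≠ e.

record AdmissibleGroup (n : ℕ) : Set where
  field
    _⊕_ : Fin n → Fin n → Fin n
    e : Fin n
    ⊖_ : Fin n → Fin n
    isAbelianGroup : AS.IsAbelianGroup (_≡_ {A = Fin n}) _⊕_ e ⊖_
    sum≡e : foldr _⊕_ e (allFin n) ≡ e
    double≢e : ∀ g → g ≢ e → g ⊕ g ≢ e

module _ {m k : ℕ} (L : Fin k → Subset m) where

  IsLinear : Set
  IsLinear = ∀ i j → i ≢ j → ∣ L i ∩ L j ∣ ≤ 1

  IsUniform : ℕ → Set
  IsUniform r = ∀ i → ∣ L i ∣ ≡ r

  degree : Fin m → ℕ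
  degree x = ∣ tabulate (λ i → lookup (L i) x) ∣

  IsTransversal : Subset m → Set
  IsTransversal T = ∀ i → ∃ λ x → x ∈ T × x ∈ L i

  IsTau : ℕ → Set
  IsTau t = (∃ λ T → IsTransversal T × ∣ T ∣ ≡ t)
          × (∀ T → IsTransversal T → t ≤ ∣ T ∣)

record IncStr : Set₁ where
  field
    Pt : Set
    Ln : Set
    _∈ₗ_ : Pt → Ln → Set

open IncStr

record _≅_ (A B : IncStr) : Set where
  field
    φ : Pt A ↔ Pt B
    ψ : Ln A ↔ Ln B
    preserves : ∀ x l →
      _⇔_ (_∈ₗ_ A x l) (_∈ₗ_ B (Inverse.to φ x) (Inverse.to ψ l))

Full : {m k : ℕ} → (Fin k → Subset m) → IncStr
Full {m} {k} L = record { Pt = Fin m ; Ln = Fin k ; _∈ₗ_ = λ x i → x ∈ L i }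

Reduced : {m k : ℕ} → (Fin k → Subset m) → IncStr
Reduced {m} {k} L = record
  { Pt = Σ (Fin m) (λ x → 2 ≤ degree L x)
  ; Ln = Fin k
  ; _∈ₗ_ = λ x i → proj₁ x ∈ L i
  }

module _ {n : ℕ} (Γ : AdmissibleGroup n) where
  open AdmissibleGroup Γ

  data CPt : Set where
    pt : (h g : Fin n) → False (g ≟ e) → CPt
    p  : CPt
    q  : CPt

  data CLn : Set where
    Lg  : (g : Fin n) → False (g ≟ e) → CLn
    lp  : (g : Fin n) → CLn
    lq  : (g : Fin n) → CLn

  _∈C_ : CPt → CLn → Set
  pt h g _ ∈C Lg g′ _ = g ≡ g′
  pt h g _ ∈C lp g′   = h ≡ g′
  pt h g _ ∈C lq g′   = g ≡ h ⊕ g′   -- (h + g′ ≠ e holds as g ≠ e)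
  p ∈C lp _ = ⊤
  q ∈C lq _ = ⊤
  _ ∈C _ = ⊥

  C : IncStr
  C = record { Pt = CPt ; Ln = CLn ; _∈ₗ_ = _∈C_ }

-- The isomorphism of the reduced system with C_{n,n+1} fixes the number of lines at 3n − 1
-- and provides at least n(n − 1) + 2 points, with equality exactly when no point was deleted.
-- The n + 1 points p, q and (e, g) for g ≠ e meet every line, so
-- τ (n + 1) ≤ (n + 1)² = (n(n − 1) + 2) + (3n − 1) ≤ |P| + |L|, and equality forces that no
-- point was deleted. Conversely τ(C_{n,n+1}) = n + 1. A transversal through p and q also
-- meets the n − 1 disjoint lines L_g; one through only one of p, q meets the n lines through
-- the other one, which share no further point. A transversal avoiding both picks a point
-- (h, s h) on each line l_{p_h}; if these were all of it, covering the lines l_{q_g} would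
-- make h ↦ s h − h a bijection of Γ, so Σ s = Σ Γ + Σ Γ = e, while covering the lines L_g
-- would make s hit every g ≠ e, so that exactly one value c ≠ e is repeated and Σ s = c.
module Submission where

open import Level using (0ℓ)
open import Data.Bool.Properties using (T-≡; T-irrelevant)
open import Data.Empty using (⊥-elim)
open import Data.Unit using (tt)
open import Data.Nat using (ℕ; zero; suc; _+_; _*_; _≤_; s≤s)
import Data.Nat.Properties as ℕ
open import Data.Nat.Tactic.RingSolver using (solve-∀)
open import Data.Fin using (Fin; zero; suc; punchIn; punchOut; _≟_)
import Data.Fin.Properties as Fin
open import Data.Fin.Permutation using (Permutation; permutation; ↔⇒≡)
open import Data.Fin.Subset using (Subset; _∈_; ∣_∣; inside; outside)
open import Data.Fin.Subset.Properties using (_∈?_)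
open import Data.Product using (Σ; ∃; _×_; _,_; proj₁; proj₂)
open import Data.Sum using (_⊎_; inj₁; inj₂)
open import Data.Sum.Function.Propositional using (_⊎-↔_)
import Data.List as List
open import Data.Vec using (_∷_; here; there; tabulate)
import Data.Vec.Properties as Vec
open import Data.Vec.Functional as Vector using (Vector; updateAt; removeAt)
  renaming (_∷_ to _∷ᶠ_)
open import Data.Vec.Functional.Properties using (updateAt-updates; updateAt-minimal)
open import Algebra.Bundles using (AbelianGroup)
import Algebra.Properties.Group as GroupProperties
import Algebra.Properties.AbelianGroup as AbelianGroupProperties
import Algebra.Properties.CommutativeMonoid.Sum as CommutativeMonoidSum
open import Function.Base using (id; const; _∘_)
open import Function.Definitions using (Injective; StrictlySurjective)
open import Function.Bundles using (_↔_; _⇔_; Inverse; Injection; Equivalence; mk⇔; mk↔ₛ′)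
open import Function.Properties.Inverse using (↔-refl; ↔-sym; ↔-trans; ↔⇒↣)
open import Relation.Nullary using (¬_; yes; no)
open import Relation.Nullary.Decidable
  using (False; isYes; toWitness; fromWitness; toWitnessFalse; fromWitnessFalse)
open import Relation.Binary.PropositionalEquality

open import Defs

injective⇒surjective : ∀ {a b} (f : Fin a → Fin b) → Injective _≡_ _≡_ f → b ≤ a →
                       StrictlySurjective _≡_ f
injective⇒surjective {a} {suc b} f f-inj b≤a y with Fin.any? (λ x → f x ≟ y)
... | yes hit  = hit
... | no  miss = ⊥-elim (ℕ.<⇒≱ (s≤s (Fin.injective⇒≤ {f = avoid} avoid-injective)) b≤a)
  where
  avoid : Fin a → Fin b
  avoid x = punchOut (miss ∘ (x ,_) ∘ sym)
  avoid-injective : Injective _≡_ _≡_ avoid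
  avoid-injective {x} {x′} =
    f-inj ∘ Fin.punchOut-injective {i = y} (miss ∘ (x ,_) ∘ sym) (miss ∘ (x′ ,_) ∘ sym)

surjective⇒permutation : ∀ {n} (f : Fin n → Fin n) → StrictlySurjective _≡_ f →
                         Σ (Permutation n n) λ π → ∀ x → Inverse.to π x ≡ f x
surjective⇒permutation f f-surj = permutation f section f∘section section∘f , λ _ → refl
  where
  section = proj₁ ∘ f-surj
  f∘section : ∀ y → f (section y) ≡ y
  f∘section = proj₂ ∘ f-surj
  section-injective : Injective _≡_ _≡_ section
  section-injective {y} {y′} eq =
    trans (sym (f∘section y)) (trans (cong f eq) (f∘section y′))
  section∘f : ∀ x → section (f x) ≡ x
  section∘f x with injective⇒surjective section section-injective ℕ.≤-refl x
  ... | y , refl = cong section (f∘section y)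

cons-injective : ∀ {A : Set} {j} {x : A} {xs : Vector A j} → Injective _≡_ _≡_ xs →
                 (∀ i → xs i ≢ x) → Injective _≡_ _≡_ (x ∷ᶠ xs)
cons-injective xs-inj fresh {zero}  {zero}  _  = refl
cons-injective xs-inj fresh {zero}  {suc j} eq = ⊥-elim (fresh j (sym eq))
cons-injective xs-inj fresh {suc i} {zero}  eq = ⊥-elim (fresh i eq)
cons-injective xs-inj fresh {suc i} {suc j} eq = cong suc (xs-inj eq)

from-injective : ∀ {A B : Set} (f : A ↔ B) → Injective _≡_ _≡_ (Inverse.from f)
from-injective f = Injection.injective (↔⇒↣ (↔-sym f))

rank : ∀ {m} (T : Subset m) (x : Fin m) → x ∈ T → Fin ∣ T ∣
rank (inside  ∷ T) zero    here       = zero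
rank (inside  ∷ T) (suc x) (there x∈T) = suc (rank T x x∈T)
rank (outside ∷ T) (suc x) (there x∈T) = rank T x x∈T

rank-injective : ∀ {m} (T : Subset m) {x y} (x∈T : x ∈ T) (y∈T : y ∈ T) →
                 rank T x x∈T ≡ rank T y y∈T → x ≡ y
rank-injective (inside  ∷ T) here        here        _  = refl
rank-injective (inside  ∷ T) (there x∈T) (there y∈T) eq =
  cong suc (rank-injective T x∈T y∈T (Fin.suc-injective eq))
rank-injective (outside ∷ T) (there x∈T) (there y∈T) eq =
  cong suc (rank-injective T x∈T y∈T eq)

unrank : ∀ {m} (T : Subset m) → Fin ∣ T ∣ → Fin m
unrank (inside  ∷ T) zero    = zero
unrank (inside  ∷ T) (suc i) = suc (unrank T i)
unrank (outside ∷ T) i       = suc (unrank T i)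

unrank-∈ : ∀ {m} (T : Subset m) i → unrank T i ∈ T
unrank-∈ (inside  ∷ T) zero    = here
unrank-∈ (inside  ∷ T) (suc i) = there (unrank-∈ T i)
unrank-∈ (outside ∷ T) i       = there (unrank-∈ T i)

unrank-injective : ∀ {m} (T : Subset m) → Injective _≡_ _≡_ (unrank T)
unrank-injective (inside  ∷ T) {zero}  {zero}  _  = refl
unrank-injective (inside  ∷ T) {suc i} {suc j} eq =
  cong suc (unrank-injective T (Fin.suc-injective eq))
unrank-injective (outside ∷ T) eq = unrank-injective T (Fin.suc-injective eq)

injective⇒≤∣∣ : ∀ {j m} (T : Subset m) (f : Fin j → Fin m) → Injective _≡_ _≡_ f →
                (∀ i → f i ∈ T) → j ≤ ∣ T ∣
injective⇒≤∣∣ T f f-inj f∈T =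
  Fin.injective⇒≤ (f-inj ∘ rank-injective T (f∈T _) (f∈T _))

covered⇒∣∣≤ : ∀ {j m} (T : Subset m) (f : Fin j → Fin m) →
              (∀ {x} → x ∈ T → ∃ λ i → f i ≡ x) → ∣ T ∣ ≤ j
covered⇒∣∣≤ T f cover = Fin.injective⇒≤ {f = index} index-injective
  where
  index : Fin ∣ T ∣ → Fin _
  index i = proj₁ (cover (unrank-∈ T i))
  index-injective : Injective _≡_ _≡_ index
  index-injective {i} {i′} eq = unrank-injective T (begin
    unrank T i          ≡⟨ proj₂ (cover (unrank-∈ T i)) ⟨
    f (index i)         ≡⟨ cong f eq ⟩
    f (index i′)        ≡⟨ proj₂ (cover (unrank-∈ T i′)) ⟩
    unrank T i′         ∎)
    where open ≡-Reasoning

injective⇒covers : ∀ {j m} (T : Subset m) (f : Fin j → Fin m) → Injective _≡_ _≡_ f →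
                   (f∈T : ∀ i → f i ∈ T) → ∣ T ∣ ≤ j → ∀ {x} → x ∈ T → ∃ λ i → f i ≡ x
injective⇒covers T f f-inj f∈T ∣T∣≤j {x} x∈T
  with injective⇒surjective (λ i → rank T (f i) (f∈T i))
         (f-inj ∘ rank-injective T (f∈T _) (f∈T _)) ∣T∣≤j (rank T x x∈T)
... | i , same-rank = i , rank-injective T (f∈T i) x∈T same-rank

image : ∀ {j m} → (Fin j → Fin m) → Subset m
image f = tabulate λ x → isYes (Fin.any? λ i → f i ≟ x)

∈-image : ∀ {j m} (f : Fin j → Fin m) i → f i ∈ image f
∈-image f i = Vec.lookup⇒[]= (f i) (image f) (trans (Vec.lookup∘tabulate _ (f i))
  (Equivalence.to T-≡ (fromWitness {a? = Fin.any? λ i′ → f i′ ≟ f i} (i , refl))))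

image-covered : ∀ {j m} (f : Fin j → Fin m) {x} → x ∈ image f → ∃ λ i → f i ≡ x
image-covered f {x} x∈image = toWitness {a? = Fin.any? λ i → f i ≟ x}
  (Equivalence.from T-≡ (trans (sym (Vec.lookup∘tabulate _ x)) (Vec.[]=⇒lookup x∈image)))

foldr-tabulate : ∀ {A B : Set} (f : A → B → B) (z : B) {j} (g : Fin j → A) →
                 List.foldr f z (List.tabulate g) ≡ Vector.foldr f z g
foldr-tabulate f z {zero}  g = refl
foldr-tabulate f z {suc j} g = cong (f (g zero)) (foldr-tabulate f z (g ∘ suc))

module GroupSums {n : ℕ} (Γ : AdmissibleGroup n) where
  open AdmissibleGroup Γ

  abelianGroup : AbelianGroup 0ℓ 0ℓ
  abelianGroup = record { isAbelianGroup = isAbelianGroup }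

  open AbelianGroup abelianGroup using (group; commutativeMonoid; identityˡ)
  open GroupProperties group using (//-rightDividesˡ)
  open AbelianGroupProperties abelianGroup using (xyx⁻¹≈y)
  open CommutativeMonoidSum commutativeMonoid
    using (sum; sum-cong-≗; sum-permute; ∑-distrib-+)
  open ≡-Reasoning

  sum-id : sum id ≡ e
  sum-id = trans (sym (foldr-tabulate _⊕_ e id)) sum≡e

  sum-surjective : (σ : Fin n → Fin n) → StrictlySurjective _≡_ σ → sum σ ≡ e
  sum-surjective σ σ-surj with surjective⇒permutation σ σ-surj
  ... | π , π≗σ = begin
    sum σ                  ≡⟨ sum-cong-≗ (sym ∘ π≗σ) ⟩
    sum (Inverse.to π)     ≡⟨ sum-permute id π ⟨
    sum id                 ≡⟨ sum-id ⟩
    e                      ∎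

  sum-of-translates : (s : Fin n → Fin n) → (∀ g → ∃ λ h → s h ≡ h ⊕ g) → sum s ≡ e
  sum-of-translates s translates = begin
    sum s                                  ≡⟨ sum-cong-≗ (λ h → //-rightDividesˡ h (s h)) ⟨
    sum (λ h → difference h ⊕ h)           ≡⟨ ∑-distrib-+ difference id ⟩
    sum difference ⊕ sum id                ≡⟨ cong₂ _⊕_ (sum-surjective difference difference-onto) sum-id ⟩
    e ⊕ e                                  ≡⟨ identityˡ e ⟩
    e                                      ∎
    where
    difference : Fin n → Fin n
    difference h = s h ⊕ (⊖ h)
    difference-onto : StrictlySurjective _≡_ difference
    difference-onto g with translates g
    ... | h , sh≡h⊕g = h , trans (cong (_⊕ (⊖ h)) sh≡h⊕g) (xyx⁻¹≈y h g)

module _ {n : ℕ} (Γ : AdmissibleGroup (suc n)) where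
  open AdmissibleGroup Γ
  open GroupSums Γ
  open AbelianGroup abelianGroup using (commutativeMonoid; identityˡ; identityʳ)
  open CommutativeMonoidSum commutativeMonoid using (sum; sum-cong-≗; sum-remove)

  sum-onto-nonNeutral≢e : (s : Fin (suc n) → Fin (suc n)) → (∀ h → s h ≢ e) →
                          (∀ g → g ≢ e → ∃ λ h → s h ≡ g) → sum s ≢ e
  sum-onto-nonNeutral≢e s avoids onto sum≡e = avoids h₂ (begin
    s h₂                            ≡⟨ identityʳ (s h₂) ⟨
    s h₂ ⊕ e                        ≡⟨ cong (s h₂ ⊕_) (sum-surjective s′ s′-onto) ⟨
    s h₂ ⊕ sum s′                   ≡⟨ cong (s h₂ ⊕_) sum-s′ ⟩
    s h₂ ⊕ sum (removeAt s h₂)      ≡⟨ sum-remove s ⟨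
    sum s                           ≡⟨ sum≡e ⟩
    e                               ∎)
    where
    open ≡-Reasoning
    collision = Fin.pigeonhole ℕ.≤-refl λ h → punchOut (avoids h ∘ sym)
    h₁ = proj₁ collision
    h₂ = proj₁ (proj₂ collision)
    h₁≢h₂ : h₁ ≢ h₂
    h₁≢h₂ = Fin.<⇒≢ (proj₁ (proj₂ (proj₂ collision)))
    sh₁≡sh₂ : s h₁ ≡ s h₂
    sh₁≡sh₂ = Fin.punchOut-injective (avoids h₁ ∘ sym) (avoids h₂ ∘ sym)
                (proj₂ (proj₂ (proj₂ collision)))

    s′ : Fin (suc n) → Fin (suc n)
    s′ = updateAt s h₂ (const e)
    s′-agrees : ∀ h → h ≢ h₂ → s′ h ≡ s h
    s′-agrees h h≢h₂ = updateAt-minimal h h₂ s h≢h₂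
    s′-onto : StrictlySurjective _≡_ s′
    s′-onto g with g ≟ e
    ... | yes refl = h₂ , updateAt-updates h₂ s
    ... | no g≢e with onto g g≢e
    ...   | h , sh≡g with h ≟ h₂
    ...     | yes refl = h₁ , trans (s′-agrees h₁ h₁≢h₂) (trans sh₁≡sh₂ sh≡g)
    ...     | no h≢h₂  = h , trans (s′-agrees h h≢h₂) sh≡g
    sum-s′ : sum s′ ≡ sum (removeAt s h₂)
    sum-s′ = begin
      sum s′                            ≡⟨ sum-remove s′ ⟩
      s′ h₂ ⊕ sum (removeAt s′ h₂)      ≡⟨ cong₂ _⊕_ (updateAt-updates h₂ s)
                                             (sum-cong-≗ λ j → s′-agrees (punchIn h₂ j) (Fin.punchInᵢ≢i h₂ j)) ⟩
      e ⊕ sum (removeAt s h₂)           ≡⟨ identityˡ _ ⟩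
      sum (removeAt s h₂)               ∎

-- The group has order suc n here, so pointCount and lineCount below are the paper's
-- n(n − 1) + 2 and 3n − 1.
module CCounting {n : ℕ} (Γ : AdmissibleGroup (suc n)) where
  open AdmissibleGroup Γ

  nonNeutral : Fin n → Fin (suc n)
  nonNeutral = punchIn e

  nonNeutral≢e : ∀ j → False (nonNeutral j ≟ e)
  nonNeutral≢e j = fromWitnessFalse (Fin.punchInᵢ≢i e j)

  nonNeutralIndex : ∀ {g} → False (g ≟ e) → Fin n
  nonNeutralIndex g≢e = punchOut (toWitnessFalse g≢e ∘ sym)

  nonNeutral-index : ∀ {g} (g≢e : False (g ≟ e)) → nonNeutral (nonNeutralIndex g≢e) ≡ g
  nonNeutral-index g≢e = Fin.punchIn-punchOut _

  pt-cong : ∀ {h g g′} {g≢e : False (g ≟ e)} {g′≢e : False (g′ ≟ e)} →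
            g ≡ g′ → pt {Γ = Γ} h g g≢e ≡ pt h g′ g′≢e
  pt-cong {g≢e = g≢e} {g′≢e} refl = cong (pt _ _) (T-irrelevant g≢e g′≢e)

  Lg-cong : ∀ {g g′} {g≢e : False (g ≟ e)} {g′≢e : False (g′ ≟ e)} →
            g ≡ g′ → Lg {Γ = Γ} g g≢e ≡ Lg g′ g′≢e
  Lg-cong {g≢e = g≢e} {g′≢e} refl = cong (Lg _) (T-irrelevant g≢e g′≢e)

  points↔ : (Fin 2 ⊎ (Fin (suc n) × Fin n)) ↔ CPt Γ
  points↔ = mk↔ₛ′ point index point∘index index∘point
    where
    point : Fin 2 ⊎ (Fin (suc n) × Fin n) → CPt Γ
    point (inj₁ zero)       = p
    point (inj₁ (suc zero)) = q
    point (inj₂ (h , j))    = pt h (nonNeutral j) (nonNeutral≢e j)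
    index : CPt Γ → Fin 2 ⊎ (Fin (suc n) × Fin n)
    index p              = inj₁ zero
    index q              = inj₁ (suc zero)
    index (pt h g g≢e)   = inj₂ (h , nonNeutralIndex g≢e)
    point∘index : ∀ x → point (index x) ≡ x
    point∘index p              = refl
    point∘index q              = refl
    point∘index (pt h g g≢e)   = pt-cong (nonNeutral-index g≢e)
    index∘point : ∀ c → index (point c) ≡ c
    index∘point (inj₁ zero)       = refl
    index∘point (inj₁ (suc zero)) = refl
    index∘point (inj₂ (h , j))    = cong (inj₂ ∘ (h ,_)) (Fin.punchOut-punchIn e)

  lines↔ : (Fin n ⊎ (Fin (suc n) ⊎ Fin (suc n))) ↔ CLn Γ
  lines↔ = mk↔ₛ′ line index line∘index index∘line
    where
    line : Fin n ⊎ (Fin (suc n) ⊎ Fin (suc n)) → CLn Γ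
    line (inj₁ j)        = Lg (nonNeutral j) (nonNeutral≢e j)
    line (inj₂ (inj₁ g)) = lp g
    line (inj₂ (inj₂ g)) = lq g
    index : CLn Γ → Fin n ⊎ (Fin (suc n) ⊎ Fin (suc n))
    index (Lg g g≢e) = inj₁ (nonNeutralIndex g≢e)
    index (lp g)     = inj₂ (inj₁ g)
    index (lq g)     = inj₂ (inj₂ g)
    line∘index : ∀ l → line (index l) ≡ l
    line∘index (Lg g g≢e) = Lg-cong (nonNeutral-index g≢e)
    line∘index (lp g)     = refl
    line∘index (lq g)     = refl
    index∘line : ∀ c → index (line c) ≡ c
    index∘line (inj₁ j)        = cong inj₁ (Fin.punchOut-punchIn e)
    index∘line (inj₂ (inj₁ g)) = refl
    index∘line (inj₂ (inj₂ g)) = refl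

  pointCount lineCount : ℕ
  pointCount = 2 + suc n * n
  lineCount  = n + (suc n + suc n)

  pointsC : Fin pointCount ↔ CPt Γ
  pointsC = ↔-trans Fin.+↔⊎ (↔-trans (↔-refl ⊎-↔ Fin.*↔×) points↔)

  linesC : Fin lineCount ↔ CLn Γ
  linesC = ↔-trans Fin.+↔⊎ (↔-trans (↔-refl ⊎-↔ Fin.+↔⊎) lines↔)

module CGeometry {n : ℕ} (Γ : AdmissibleGroup (suc n)) where
  open AdmissibleGroup Γ

  infix 4 _∈ᶜ_
  _∈ᶜ_ : CPt Γ → CLn Γ → Set
  _∈ᶜ_ = _∈C_ Γ

  -- p and q are given the junk coordinates (e , e).
  first second : CPt Γ → Fin (suc n)
  first (pt h _ _) = h
  first p          = e
  first q          = e
  second (pt _ g _) = g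
  second p          = e
  second q          = e

  second-on-Lg : ∀ {y g g≢e} → y ∈ᶜ Lg g g≢e → second y ≡ g
  second-on-Lg {pt _ _ _} y∈l = y∈l

  first-on-lp : ∀ {y h} → y ∈ᶜ lp h → y ≢ p → first y ≡ h
  first-on-lp {pt _ _ _} y∈l _  = y∈l
  first-on-lp {p}        _  y≢p = ⊥-elim (y≢p refl)

  second-on-lq : ∀ {y g} → y ∈ᶜ lq g → y ≢ q → second y ≡ first y ⊕ g
  second-on-lq {pt _ _ _} y∈l _  = y∈l
  second-on-lq {q}        _  y≢q = ⊥-elim (y≢q refl)

  second≢e : ∀ y → y ≢ p → y ≢ q → second y ≢ e
  second≢e (pt _ _ g≢e) _   _   = toWitnessFalse g≢e
  second≢e p            y≢p _   = ⊥-elim (y≢p refl)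
  second≢e q            _   y≢q = ⊥-elim (y≢q refl)

module CTransversal {n m k : ℕ} (Γ : AdmissibleGroup (suc n)) {L : Fin k → Subset m}
                    (iso : Full L ≅ C Γ) {T : Subset m} (transversal : IsTransversal L T) where
  open AdmissibleGroup Γ
  open CCounting Γ using (nonNeutral; nonNeutral≢e)
  open CGeometry Γ
  open GroupSums Γ using (abelianGroup; sum-of-translates)
  open AbelianGroup abelianGroup using (group)
  open GroupProperties group using (∙-cancelˡ)
  module Φ = Inverse (_≅_.φ iso)
  module Ψ = Inverse (_≅_.ψ iso)

  Chosen : CPt Γ → Set
  Chosen y = Φ.from y ∈ T

  pick : CLn Γ → CPt Γ
  pick l = Φ.to (proj₁ (transversal (Ψ.from l)))

  pick-chosen : ∀ l → Chosen (pick l)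
  pick-chosen l = subst (_∈ T) (sym (Φ.strictlyInverseʳ _)) (proj₁ (proj₂ (transversal (Ψ.from l))))

  pick-on : ∀ l → pick l ∈ᶜ l
  pick-on l = subst (pick l ∈ᶜ_) (Ψ.strictlyInverseˡ l)
    (Equivalence.to (_≅_.preserves iso _ (Ψ.from l)) (proj₂ (proj₂ (transversal (Ψ.from l)))))

  pick≢off : ∀ l {y} → ¬ y ∈ᶜ l → pick l ≢ y
  pick≢off l y∉l refl = y∉l (pick-on l)

  pick≢unchosen : ∀ l {y} → ¬ Chosen y → pick l ≢ y
  pick≢unchosen l y∉T refl = y∉T (pick-chosen l)

  count : ∀ {j} (f : Fin j → CPt Γ) → Injective _≡_ _≡_ f → (∀ i → Chosen (f i)) → j ≤ ∣ T ∣
  count f f-inj = injective⇒≤∣∣ T (Φ.from ∘ f) (f-inj ∘ from-injective (_≅_.φ iso))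

  rows : Fin n → CPt Γ
  rows j = pick (Lg (nonNeutral j) (nonNeutral≢e j))

  columns diagonals : Fin (suc n) → CPt Γ
  columns   h = pick (lp h)
  diagonals g = pick (lq g)

  rows-injective : Injective _≡_ _≡_ rows
  rows-injective {i} {j} eq = Fin.punchIn-injective e i j
    (trans (sym (second-on-Lg (pick-on _))) (trans (cong second eq) (second-on-Lg (pick-on _))))

  module _ (p∉T : ¬ Chosen p) where

    first-columns : ∀ h → first (columns h) ≡ h
    first-columns h = first-on-lp (pick-on (lp h)) (pick≢unchosen _ p∉T)

    columns-injective : Injective _≡_ _≡_ columns
    columns-injective {h} {h′} eq =
      trans (sym (first-columns h)) (trans (cong first eq) (first-columns h′))

  module _ (q∉T : ¬ Chosen q) where

    second-diagonals : ∀ g → second (diagonals g) ≡ first (diagonals g) ⊕ g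
    second-diagonals g = second-on-lq (pick-on (lq g)) (pick≢unchosen _ q∉T)

    diagonals-injective : Injective _≡_ _≡_ diagonals
    diagonals-injective {g} {g′} eq = ∙-cancelˡ (first (diagonals g)) g g′ (begin
      first (diagonals g) ⊕ g     ≡⟨ second-diagonals g ⟨
      second (diagonals g)        ≡⟨ cong second eq ⟩
      second (diagonals g′)       ≡⟨ second-diagonals g′ ⟩
      first (diagonals g′) ⊕ g′   ≡⟨ cong (λ y → first y ⊕ g′) eq ⟨
      first (diagonals g) ⊕ g′    ∎)
      where open ≡-Reasoning

  through-p-and-q : Chosen p → Chosen q → suc (suc n) ≤ ∣ T ∣
  through-p-and-q p∈T q∈T = count (p ∷ᶠ q ∷ᶠ rows)
    (cons-injective (cons-injective rows-injective (λ j → pick≢off _ λ ()))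
                    λ { zero → λ () ; (suc j) → pick≢off _ λ () })
    λ { zero → p∈T ; (suc zero) → q∈T ; (suc (suc j)) → pick-chosen _ }

  through-p-only : Chosen p → ¬ Chosen q → suc (suc n) ≤ ∣ T ∣
  through-p-only p∈T q∉T = count (p ∷ᶠ diagonals)
    (cons-injective (diagonals-injective q∉T) λ g → pick≢off _ λ ())
    λ { zero → p∈T ; (suc g) → pick-chosen _ }

  through-q-only : ¬ Chosen p → Chosen q → suc (suc n) ≤ ∣ T ∣
  through-q-only p∉T q∈T = count (q ∷ᶠ columns)
    (cons-injective (columns-injective p∉T) λ h → pick≢off _ λ ())
    λ { zero → q∈T ; (suc h) → pick-chosen _ }

  through-neither : ¬ Chosen p → ¬ Chosen q → suc (suc n) ≤ ∣ T ∣
  through-neither p∉T q∉T = ℕ.≤∧≢⇒< ∣Γ∣≤∣T∣ ∣Γ∣≢∣T∣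
    where
    ∣Γ∣≤∣T∣ : suc n ≤ ∣ T ∣
    ∣Γ∣≤∣T∣ = count columns (columns-injective p∉T) (pick-chosen ∘ lp)

    ∣Γ∣≢∣T∣ : suc n ≢ ∣ T ∣
    ∣Γ∣≢∣T∣ ∣Γ∣≡∣T∣ = sum-onto-nonNeutral≢e Γ s s≢e s-onto (sum-of-translates s s-translates)
      where
      column-of : ∀ l → ∃ λ h → columns h ≡ pick l
      column-of l with injective⇒covers T (Φ.from ∘ columns)
                         (columns-injective p∉T ∘ from-injective (_≅_.φ iso))
                         (pick-chosen ∘ lp) (ℕ.≤-reflexive (sym ∣Γ∣≡∣T∣)) (pick-chosen l)
      ... | h , same = h , from-injective (_≅_.φ iso) same

      s : Fin (suc n) → Fin (suc n)
      s = second ∘ columns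

      s≢e : ∀ h → s h ≢ e
      s≢e h = second≢e _ (pick≢unchosen _ p∉T) (pick≢off _ λ ())

      s-translates : ∀ g → ∃ λ h → s h ≡ h ⊕ g
      s-translates g with column-of (lq g)
      ... | h , same = h , (begin
        second (columns h)                ≡⟨ cong second same ⟩
        second (diagonals g)              ≡⟨ second-diagonals q∉T g ⟩
        first (diagonals g) ⊕ g           ≡⟨ cong (λ y → first y ⊕ g) same ⟨
        first (columns h) ⊕ g             ≡⟨ cong (_⊕ g) (first-columns p∉T h) ⟩
        h ⊕ g                             ∎)
        where open ≡-Reasoning

      s-onto : ∀ g → g ≢ e → ∃ λ h → s h ≡ g
      s-onto g g≢e with column-of (Lg g (fromWitnessFalse g≢e))
      ... | h , same = h , trans (cong second same) (second-on-Lg (pick-on _))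

  transversal-size : suc (suc n) ≤ ∣ T ∣
  transversal-size with Φ.from p ∈? T | Φ.from q ∈? T
  ... | yes p∈T | yes q∈T = through-p-and-q p∈T q∈T
  ... | yes p∈T | no  q∉T = through-p-only p∈T q∉T
  ... | no  p∉T | yes q∈T = through-q-only p∉T q∈T
  ... | no  p∉T | no  q∉T = through-neither p∉T q∉T

module CReduced {n m k : ℕ} (Γ : AdmissibleGroup (suc n)) {L : Fin k → Subset m}
                (iso : Reduced L ≅ C Γ) where
  open AdmissibleGroup Γ
  open CCounting Γ
  open CGeometry Γ using (_∈ᶜ_)
  module φ = Inverse (_≅_.φ iso)
  module ψ = Inverse (_≅_.ψ iso)

  lines-count : k ≡ lineCount
  lines-count = ↔⇒≡ (↔-trans (_≅_.ψ iso) (↔-sym linesC))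

  reduced-≡ : {x y : Σ (Fin m) λ x → 2 ≤ degree L x} → proj₁ x ≡ proj₁ y → x ≡ y
  reduced-≡ refl = cong (_ ,_) (ℕ.≤-irrelevant _ _)

  point : CPt Γ → Fin m
  point = proj₁ ∘ φ.from

  point-injective : Injective _≡_ _≡_ point
  point-injective = from-injective (_≅_.φ iso) ∘ reduced-≡

  numbered-point : Fin pointCount → Fin m
  numbered-point = point ∘ Inverse.to pointsC

  numbered-point-injective : Injective _≡_ _≡_ numbered-point
  numbered-point-injective = Injection.injective (↔⇒↣ pointsC) ∘ point-injective

  points-lower : pointCount ≤ m
  points-lower = Fin.injective⇒≤ numbered-point-injective

  point-on : ∀ {y} l → y ∈ᶜ ψ.to l → point y ∈ L l
  point-on {y} l y∈l = Equivalence.from (_≅_.preserves iso (φ.from y) l)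
    (subst (_∈ᶜ ψ.to l) (sym (φ.strictlyInverseˡ y)) y∈l)

  hub : Fin (suc (suc n)) → CPt Γ
  hub = p ∷ᶠ q ∷ᶠ λ j → pt e (nonNeutral j) (nonNeutral≢e j)

  hub-meets : ∀ l → ∃ λ i → hub i ∈ᶜ l
  hub-meets (Lg g g≢e) = suc (suc (nonNeutralIndex g≢e)) , nonNeutral-index g≢e
  hub-meets (lp g)     = zero , tt
  hub-meets (lq g)     = suc zero , tt

  hub-transversal : IsTransversal L (image (point ∘ hub))
  hub-transversal l with hub-meets (ψ.to l)
  ... | i , hub-i∈l = point (hub i) , ∈-image (point ∘ hub) i , point-on l hub-i∈l

  τ≤∣Γ∣+1 : ∀ {t} → IsTau L t → t ≤ suc (suc n)
  τ≤∣Γ∣+1 (_ , minimal) = ℕ.≤-trans (minimal _ hub-transversal)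
                                     (covered⇒∣∣≤ _ (point ∘ hub) (image-covered (point ∘ hub)))

  few-points⇒full : m ≤ pointCount → Full L ≅ C Γ
  few-points⇒full m≤ = record
    { φ = mk↔ₛ′ (λ x → φ.to (x , deg x)) point
                (λ y → trans (cong φ.to (reduced-≡ refl)) (φ.strictlyInverseˡ y))
                (λ x → cong proj₁ (φ.strictlyInverseʳ (x , deg x)))
    ; ψ = _≅_.ψ iso
    ; preserves = λ x → _≅_.preserves iso (x , deg x)
    }
    where
    deg : ∀ x → 2 ≤ degree L x
    deg x with injective⇒surjective numbered-point numbered-point-injective m≤ x
    ... | c , refl = proj₂ (φ.from (Inverse.to pointsC c))

full-point-count : ∀ {n m k} (Γ : AdmissibleGroup (suc n)) {L : Fin k → Subset m} →
                   Full L ≅ C Γ → m ≡ CCounting.pointCount Γ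
full-point-count Γ iso = ↔⇒≡ (↔-trans (_≅_.φ iso) (↔-sym (CCounting.pointsC Γ)))

points+lines : ∀ n → (2 + suc n * n) + (n + (suc n + suc n)) ≡ suc (suc n) * suc (suc n)
points+lines = solve-∀

corollary2p10 : (n : ℕ) → 3 ≤ n → Odd n → (Γ : AdmissibleGroup n) →
    (r m k : ℕ) (L : Fin k → Subset m) →
    IsLinear L → IsUniform L r → n ≤ r → Reduced L ≅ C Γ →
    (t : ℕ) → IsTau L t →
    (t * suc n ≤ m + k) × (_⇔_ (t * suc n ≡ m + k) (Full L ≅ C Γ))
corollary2p10 (suc n) _ _ Γ _ m k L _ _ _ iso t τ = bound , mk⇔ equality⇒full full⇒equality
  where
  open CCounting Γ using (pointCount; lineCount)
  open CReduced Γ iso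
  open ℕ.≤-Reasoning

  τ-bound-by-counts : t * suc (suc n) ≤ pointCount + lineCount
  τ-bound-by-counts = begin
    t * suc (suc n)             ≤⟨ ℕ.*-monoˡ-≤ (suc (suc n)) (τ≤∣Γ∣+1 τ) ⟩
    suc (suc n) * suc (suc n)   ≡⟨ points+lines n ⟨
    pointCount + lineCount      ∎

  bound : t * suc (suc n) ≤ m + k
  bound = ℕ.≤-trans τ-bound-by-counts (ℕ.+-mono-≤ points-lower (ℕ.≤-reflexive (sym lines-count)))

  equality⇒full : t * suc (suc n) ≡ m + k → Full L ≅ C Γ
  equality⇒full equality = few-points⇒full (ℕ.+-cancelʳ-≤ lineCount m pointCount (begin
    m + lineCount               ≡⟨ cong (m +_) lines-count ⟨
    m + k                       ≡⟨ equality ⟨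
    t * suc (suc n)             ≤⟨ τ-bound-by-counts ⟩
    pointCount + lineCount      ∎))

  full⇒equality : Full L ≅ C Γ → t * suc (suc n) ≡ m + k
  full⇒equality full = begin-equality
    t * suc (suc n)             ≡⟨ cong (_* suc (suc n)) τ≡∣Γ∣+1 ⟩
    suc (suc n) * suc (suc n)   ≡⟨ points+lines n ⟨
    pointCount + lineCount      ≡⟨ cong₂ _+_ (full-point-count Γ full) lines-count ⟨
    m + k                       ∎
    where
    τ≡∣Γ∣+1 : t ≡ suc (suc n)
    τ≡∣Γ∣+1 with proj₁ τ
    ... | T , transversal , refl =
      ℕ.≤-antisym (τ≤∣Γ∣+1 τ) (CTransversal.transversal-size Γ full transversal)
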